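{- For every $n\geq 1$ and every $P\in\mathcal{D}_n^{h,\geq}$, $$\#DUD(P)=\#F(\phi(P))-\#UF^+D(\phi(P))-\delta_{F^n}(\phi(P)),$$ where $\delta_{F^n}(Q)=1$ if $Q=F^n$ and $\delta_{F^n}(Q)=0$ otherwise.
   Context: A Motzkin path of length $n$ is a word in the steps $U=(1,1)$, $D=(1,-1)$, $F=(1,0)$ forming a lattice path from $(0,0)$ to $(n,0)$ never going below the $x$-axis; $\mathcal{M}_n$ is the set of them. A Dyck path of semilength $n$ is a Motzkin path of length $2n$ without $F$ steps. Every nonempty Dyck path has a unique first return decomposition $P=U\alpha D\beta$ with $\alpha,\beta$ Dyck paths; $h$ denotes maximal height. $\mathcal{D}^{h,\geq}$ is defined recursively: it contains the empty path $\epsilon$, and $P=U\alpha D\beta$ belongs to it iff $\alpha,\beta\in\mathcal{D}^{h,\geq}$ and $h(U\alpha D)\geq h(\beta)$; $\mathcal{D}_n^{h,\geq}$ is the subset of semilength $n$. The bijection $\phi:\mathcal{D}_n^{h,\geq}\to\mathcal{M}_n$ is defined by $\phi(\epsilon)=\epsilon$, $\phi(\alpha UD)=\phi(\alpha)F$, $\phi(\alpha UU\beta D\gamma D)=\phi(\alpha)\phi(\gamma)U\phi(\beta)D$. For a word $X$, $\#X(P)$ is the number of occurrences of $X$ as consecutive steps in $P$. For words $Y,Z$ and a step $S$, $\#YS^+Z(P)=\sum_{k\geq 1}\#YS^kZ(P)$, where $S^k$ is $k$ consecutive copies of $S$. -}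

module Defs where

open import Data.Nat using (ℕ; zero; suc; _+_; _*_; _∸_; _≥_)
open import Data.Bool using (Bool; true; false; if_then_else_)
open import Data.List using (List; []; _∷_; _++_; [_]; length; reverse; replicate; map; drop)
open import Data.Nat.ListAction using (sum)
open import Data.List.Base using (upTo)
open import Data.Product using (_×_; _,_)
open import Data.Maybe using (Maybe; just; nothing)
open import Relation.Binary.PropositionalEquality using (_≡_)

-- Steps U=(1,1), D=(1,-1), F=(1,0); a path is a word (list) of steps.
data Step : Set where
  U D F : Step

Word : Set
Word = List Step

stepEq : Step → Step → Bool
stepEq U U = true
stepEq D D = true
stepEq F F = true
stepEq _ _ = false

wordEq : Word → Word → Bool
wordEq [] [] = true
wordEq (x ∷ xs) (y ∷ ys) = if stepEq x y then wordEq xs ys else false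
wordEq _ _ = false

-- maximal height h of a path (starting at height 0, all prefixes ≥ 0):
-- h(Uw) = 1 + h(w), h(Dw) = max(0, h(w) - 1), h(Fw) = h(w).
h : Word → ℕ
h [] = 0
h (U ∷ w) = suc (h w)
h (D ∷ w) = h w ∸ 1
h (F ∷ w) = h w

-- 𝒟^{h,≥}: the recursive family of Dyck paths, via the first return
-- decomposition P = U α D β  (α a Dyck path, hence this is the first return).
data Dhgeq : Word → Set where
  empty : Dhgeq []
  node  : ∀ {α β} → Dhgeq α → Dhgeq β → h (U ∷ α ++ [ D ]) ≥ h β →
          Dhgeq (U ∷ α ++ D ∷ β)

DhgeqN : ℕ → Word → Set
DhgeqN n P = Dhgeq P × (length P ≡ 2 * n)

-- Last-return decomposition: w = α U β D with β a Dyck path. Returns (α , β).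
scanBack : ℕ → Word → Word → Maybe (Word × Word)
scanBack c acc [] = nothing
scanBack c acc (D ∷ r) = scanBack (suc c) (D ∷ acc) r
scanBack zero acc (U ∷ r) = just (reverse r , acc)
scanBack (suc c) acc (U ∷ r) = scanBack c (U ∷ acc) r
scanBack c acc (F ∷ r) = scanBack c (F ∷ acc) r

splitLast : Word → Maybe (Word × Word)
splitLast w with reverse w
... | D ∷ r = scanBack 0 [] r
... | _ = nothing

-- First-return decomposition: β = U β' D γ. Returns (β' , γ).
scanFwd : ℕ → Word → Word → Maybe (Word × Word)
scanFwd c acc [] = nothing
scanFwd c acc (U ∷ r) = scanFwd (suc c) (U ∷ acc) r
scanFwd zero acc (D ∷ r) = just (reverse acc , r)
scanFwd (suc c) acc (D ∷ r) = scanFwd c (D ∷ acc) r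
scanFwd c acc (F ∷ r) = scanFwd c (F ∷ acc) r

splitFirst : Word → Maybe (Word × Word)
splitFirst (U ∷ r) = scanFwd 0 [] r
splitFirst _ = nothing

-- φ with fuel (every recursive call is on a strictly shorter word,
-- so fuel = length suffices):
--   φ(ε) = ε, φ(α U D) = φ(α) F, φ(α U U β D γ D) = φ(α) φ(γ) U φ(β) D.
phiF : ℕ → Word → Word
phiF zero _ = []
phiF (suc k) [] = []
phiF (suc k) (x ∷ w) with splitLast (x ∷ w)
... | nothing = []
... | just (α , []) = phiF k α ++ [ F ]
... | just (α , β@(_ ∷ _)) with splitFirst β
...   | nothing = []
...   | just (β' , γ) = phiF k α ++ phiF k γ ++ U ∷ phiF k β' ++ [ D ]

φ : Word → Word
φ w = phiF (length w) w

isPrefix : Word → Word → Bool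
isPrefix [] _ = true
isPrefix (x ∷ xs) [] = false
isPrefix (x ∷ xs) (y ∷ ys) = if stepEq x y then isPrefix xs ys else false

count : Word → Word → ℕ
count X [] = if isPrefix X [] then 1 else 0
count X (y ∷ ys) = (if isPrefix X (y ∷ ys) then 1 else 0) + count X ys

-- #U F^+ D (P) = Σ_{k ≥ 1} #U F^k D (P); terms with k > length P vanish,
-- so the sum is taken over 1 ≤ k ≤ length P.
countUFplusD : Word → ℕ
countUFplusD P = sum (map (λ i → count (U ∷ replicate (suc i) F ++ [ D ]) P) (upTo (length P)))

δF : ℕ → Word → ℕ
δF n Q = if wordEq Q (replicate n F) then 1 else 0

-- Evaluate φ along first returns: P = U α D β goes to F φ(β) when α = ε and to
-- φ(α₂) U φ(α₁) D φ(β) when α = U α₁ D α₂.  By induction along this recursion,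
-- #F(φ(P)) = #UF⁺D(φ(P)) + #DUD(P) + [P begins with UD]: the indicator terms of
-- α₂ and β reappear as the DUD factors at the junctions D·UD of P, and that of α₁
-- as the factor U φ(α₁) D, which is of the form UF⁺D exactly when φ(α₁) is a
-- nonempty flat word.  The height condition of 𝒟^{h,≥} makes the latter happen
-- exactly when α₁ begins with UD; likewise φ(P) = Fⁿ exactly when P begins with UD.

module Submission where

open import Defs
open import Data.Nat using (ℕ; zero; suc; _+_; _*_; _≤_; _<_; _≥_; z≤n; s≤s)
open import Data.Nat.Properties
  using (≤-refl; ≤-trans; ≤-pred; n≤1+n; +-suc; +-assoc; *-distribˡ-+; *-cancelˡ-≡; +-commutativeSemigroup)
open import Algebra.Properties.CommutativeSemigroup +-commutativeSemigroup
  using () renaming (interchange to +-interchange)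
open import Data.Nat.Tactic.RingSolver using (solve-∀)
open import Data.List using (List; []; _∷_; _++_; [_]; reverse; length; last; replicate; applyUpTo; _ʳ++_)
open import Data.Nat.ListAction using (sum)
open import Data.Bool using (Bool; true; false; if_then_else_)
open import Data.List.Properties
  using (++-assoc; ++-ʳ++; ++-identityʳ; reverse-involutive; length-++; length-++-≤ˡ; length-++-≤ʳ; map-upTo)
open import Data.Product using (_,_)
open import Data.Maybe using (Maybe; just; nothing; _<∣>_)
open import Data.Maybe.Properties using (<∣>-identityʳ)
open import Function using (_∘_)
open import Relation.Binary.PropositionalEquality
  using (_≡_; refl; sym; trans; cong; cong₂; subst; module ≡-Reasoning)

data Dyck : Word → Set where
  empty : Dyck []
  node  : ∀ {α β} → Dyck α → Dyck β → Dyck (U ∷ α ++ D ∷ β)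

-- Reading a Dyck word backwards (resp. forwards) never brings the counter of
-- scanBack (resp. scanFwd) below its starting value, so the scan passes it whole.
scanBack-skipsDyck : ∀ {β} → Dyck β → ∀ c acc rest →
                     scanBack c acc (β ʳ++ rest) ≡ scanBack c (β ++ acc) rest
scanBack-skipsDyck empty c acc rest = refl
scanBack-skipsDyck (node {α} {β} dα dβ) c acc rest = begin
  scanBack c acc ((U ∷ α ++ D ∷ β) ʳ++ rest)
    ≡⟨ cong (scanBack c acc) (++-ʳ++ α) ⟩
  scanBack c acc (β ʳ++ D ∷ α ʳ++ U ∷ rest)
    ≡⟨ scanBack-skipsDyck dβ c acc _ ⟩
  scanBack (suc c) (D ∷ β ++ acc) (α ʳ++ U ∷ rest)
    ≡⟨ scanBack-skipsDyck dα (suc c) _ _ ⟩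
  scanBack c (U ∷ α ++ D ∷ β ++ acc) rest
    ≡⟨ cong (λ t → scanBack c (U ∷ t) rest) (++-assoc α (D ∷ β) acc) ⟨
  scanBack c ((U ∷ α ++ D ∷ β) ++ acc) rest ∎
  where open ≡-Reasoning

scanFwd-skipsDyck : ∀ {β} → Dyck β → ∀ c acc rest →
                    scanFwd c acc (β ++ rest) ≡ scanFwd c (β ʳ++ acc) rest
scanFwd-skipsDyck empty c acc rest = refl
scanFwd-skipsDyck (node {α} {β} dα dβ) c acc rest = begin
  scanFwd c acc ((U ∷ α ++ D ∷ β) ++ rest)
    ≡⟨ cong (scanFwd (suc c) (U ∷ acc)) (++-assoc α (D ∷ β) rest) ⟩
  scanFwd (suc c) (U ∷ acc) (α ++ D ∷ β ++ rest)
    ≡⟨ scanFwd-skipsDyck dα (suc c) _ _ ⟩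
  scanFwd c (D ∷ α ʳ++ U ∷ acc) (β ++ rest)
    ≡⟨ scanFwd-skipsDyck dβ c _ rest ⟩
  scanFwd c (β ʳ++ D ∷ α ʳ++ U ∷ acc) rest
    ≡⟨ cong (λ t → scanFwd c t rest) (++-ʳ++ α) ⟨
  scanFwd c ((U ∷ α ++ D ∷ β) ʳ++ acc) rest ∎
  where open ≡-Reasoning

splitLast-via-reverse : ∀ w r → reverse w ≡ D ∷ r → splitLast w ≡ scanBack 0 [] r
splitLast-via-reverse w r eq with reverse w
splitLast-via-reverse w r refl | .(D ∷ r) = refl

splitLast-lastReturn : ∀ α {β} → Dyck β → splitLast (α ++ U ∷ β ++ [ D ]) ≡ just (α , β)
splitLast-lastReturn α {β} dβ = begin
  splitLast (α ++ U ∷ β ++ [ D ])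
    ≡⟨ splitLast-via-reverse (α ++ U ∷ β ++ [ D ]) _ (trans (++-ʳ++ α) (++-ʳ++ β)) ⟩
  scanBack 0 [] (β ʳ++ U ∷ reverse α)
    ≡⟨ scanBack-skipsDyck dβ 0 [] _ ⟩
  just (reverse (reverse α) , β ++ [])
    ≡⟨ cong₂ (λ x y → just (x , y)) (reverse-involutive α) (++-identityʳ β) ⟩
  just (α , β) ∎
  where open ≡-Reasoning

splitFirst-firstReturn : ∀ {α} β → Dyck α → splitFirst (U ∷ α ++ D ∷ β) ≡ just (α , β)
splitFirst-firstReturn {α} β dα =
  trans (scanFwd-skipsDyck dα 0 [] (D ∷ β)) (cong (λ x → just (x , β)) (reverse-involutive α))

-- φ(UD) = F and φ(U U β D γ D) = φ(γ) U φ(β) D, and φ is multiplicative over the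
-- factorisation of a Dyck path into primes; Φ evaluates it along first returns.
Φ : ∀ {w} → Dyck w → Word
Φ empty                   = []
Φ (node empty dβ)         = F ∷ Φ dβ
Φ (node (node dα dα′) dβ) = Φ dα′ ++ U ∷ Φ dα ++ D ∷ Φ dβ

record LastReturn {w} (d : Dyck w) : Set where
  field
    {rest inner} : Word
    dRest        : Dyck rest
    dInner       : Dyck inner
    split        : w ≡ rest ++ U ∷ inner ++ [ D ]
    Φ-split      : Φ d ≡ Φ dRest ++ Φ (node dInner empty)

lastReturn : ∀ {α β} (dα : Dyck α) (dβ : Dyck β) → LastReturn (node dα dβ)
lastReturn dα empty = record { dRest = empty ; dInner = dα ; split = refl ; Φ-split = refl }
lastReturn {α} dα (node dγ dδ) = record
  { dRest   = node dα dRest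
  ; dInner  = dInner
  ; split   = trans (cong (λ t → U ∷ α ++ D ∷ t) split) (cong (U ∷_) (sym (++-assoc α (D ∷ rest) _)))
  ; Φ-split = Φ-split′ dα
  }
  where
  open LastReturn (lastReturn dγ dδ)
  Φ-split′ : ∀ {α} (dα : Dyck α) → Φ (node dα (node dγ dδ)) ≡ Φ (node dα dRest) ++ Φ (node dInner empty)
  Φ-split′ empty           = cong (F ∷_) Φ-split
  Φ-split′ (node dα₁ dα₂) = begin
    Φ dα₂ ++ U ∷ Φ dα₁ ++ D ∷ Φ (node dγ dδ)
      ≡⟨ cong (λ t → Φ dα₂ ++ U ∷ Φ dα₁ ++ D ∷ t) Φ-split ⟩
    Φ dα₂ ++ U ∷ Φ dα₁ ++ D ∷ Φ dRest ++ Φ (node dInner empty)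
      ≡⟨ cong (λ t → Φ dα₂ ++ U ∷ t) (++-assoc (Φ dα₁) (D ∷ Φ dRest) _) ⟨
    Φ dα₂ ++ U ∷ (Φ dα₁ ++ D ∷ Φ dRest) ++ Φ (node dInner empty)
      ≡⟨ ++-assoc (Φ dα₂) (U ∷ Φ dα₁ ++ D ∷ Φ dRest) _ ⟨
    (Φ dα₂ ++ U ∷ Φ dα₁ ++ D ∷ Φ dRest) ++ Φ (node dInner empty) ∎
    where open ≡-Reasoning

phiF-unfold-UD : ∀ k x w α → splitLast (x ∷ w) ≡ just (α , []) →
                 phiF (suc k) (x ∷ w) ≡ phiF k α ++ [ F ]
phiF-unfold-UD k x w α eq with splitLast (x ∷ w) | eq
... | _ | refl = refl

phiF-unfold-UUβDγD : ∀ k x w α β γ →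
                     splitLast (x ∷ w) ≡ just (α , U ∷ β ++ D ∷ γ) →
                     splitFirst (U ∷ β ++ D ∷ γ) ≡ just (β , γ) →
                     phiF (suc k) (x ∷ w) ≡ phiF k α ++ phiF k γ ++ U ∷ phiF k β ++ [ D ]
phiF-unfold-UUβDγD k x w α β γ eq eq′ with splitLast (x ∷ w) | eq
... | _ | refl with splitFirst (U ∷ β ++ D ∷ γ) | eq′
...   | _ | refl = refl

length-<-++∷ : ∀ {A : Set} (xs : List A) {x ys} → length xs < length (xs ++ x ∷ ys)
length-<-++∷ []       = s≤s z≤n
length-<-++∷ (_ ∷ xs) = s≤s (length-<-++∷ xs)

phiF-agrees : ∀ k {w} (d : Dyck w) → length w ≤ k → phiF k w ≡ Φ d
phiF-agrees zero    empty _ = refl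
phiF-agrees (suc k) empty _ = refl
phiF-agrees (suc k) (node {α} {β} dα dβ) w≤ =
  trans (agree dInner inner≤ (trans (cong splitLast split) (splitLast-lastReturn rest dInner))) (sym Φ-split)
  where
  open LastReturn (lastReturn dα dβ)
  w≤′ : length (rest ++ U ∷ inner ++ [ D ]) ≤ suc k
  w≤′ = subst (λ v → length v ≤ suc k) split w≤
  rest≤ : length rest ≤ k
  rest≤ = ≤-pred (≤-trans (length-<-++∷ rest) w≤′)
  inner≤ : length inner ≤ k
  inner≤ = ≤-pred (≤-trans (s≤s (length-++-≤ˡ inner)) (≤-trans (length-++-≤ʳ (U ∷ inner ++ [ D ]) {rest}) w≤′))
  agree : ∀ {inner} (dInner : Dyck inner) → length inner ≤ k →
          splitLast (U ∷ α ++ D ∷ β) ≡ just (rest , inner) →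
          phiF (suc k) (U ∷ α ++ D ∷ β) ≡ Φ dRest ++ Φ (node dInner empty)
  agree empty _ eq =
    trans (phiF-unfold-UD k U (α ++ D ∷ β) rest eq) (cong (_++ [ F ]) (phiF-agrees k dRest rest≤))
  agree (node {β₁} {γ} dβ₁ dγ) inner≤ eq =
    trans (phiF-unfold-UUβDγD k U (α ++ D ∷ β) rest β₁ γ eq (splitFirst-firstReturn γ dβ₁))
          (cong₂ _++_ (phiF-agrees k dRest rest≤)
                      (cong₂ _++_ (phiF-agrees k dγ γ≤) (cong (λ t → U ∷ t ++ [ D ]) (phiF-agrees k dβ₁ β₁≤))))
    where
    β₁≤ : length β₁ ≤ k
    β₁≤ = ≤-trans (≤-trans (length-++-≤ˡ β₁) (n≤1+n _)) inner≤
    γ≤ : length γ ≤ k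
    γ≤ = ≤-trans (≤-trans (n≤1+n _) (≤-trans (length-++-≤ʳ (D ∷ γ) {β₁}) (n≤1+n _))) inner≤

φ≡Φ : ∀ {w} (d : Dyck w) → φ w ≡ Φ d
φ≡Φ d = phiF-agrees _ d ≤-refl

length-node : ∀ α β → length (U ∷ α ++ D ∷ β) ≡ 2 + (length α + length β)
length-node α β = trans (cong suc (length-++ α)) (cong suc (+-suc (length α) (length β)))

length-Φ : ∀ {w} (d : Dyck w) → length w ≡ 2 * length (Φ d)
length-Φ empty = refl
length-Φ (node {β = β} empty dβ) = begin
  2 + length β                  ≡⟨ cong (2 +_) (length-Φ dβ) ⟩
  2 + 2 * length (Φ dβ)         ≡⟨ *-distribˡ-+ 2 1 (length (Φ dβ)) ⟨
  2 * (1 + length (Φ dβ))       ∎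
  where open ≡-Reasoning
length-Φ (node {β = β} (node {α} {α′} dα dα′) dβ) = begin
  length (U ∷ (U ∷ α ++ D ∷ α′) ++ D ∷ β)
    ≡⟨ length-node (U ∷ α ++ D ∷ α′) β ⟩
  2 + (length (U ∷ α ++ D ∷ α′) + length β)
    ≡⟨ cong (λ t → 2 + (t + length β)) (length-node α α′) ⟩
  2 + ((2 + (length α + length α′)) + length β)
    ≡⟨ cong₂ (λ s t → 2 + ((2 + s) + t)) (cong₂ _+_ (length-Φ dα) (length-Φ dα′)) (length-Φ dβ) ⟩
  2 + ((2 + (2 * x + 2 * x′)) + 2 * y)
    ≡⟨ rearrange x x′ y ⟩
  2 * (x′ + (2 + (x + y)))
    ≡⟨ cong ((2 *_) ∘ (x′ +_)) (length-node (Φ dα) (Φ dβ)) ⟨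
  2 * (x′ + length (U ∷ Φ dα ++ D ∷ Φ dβ))
    ≡⟨ cong (2 *_) (length-++ (Φ dα′)) ⟨
  2 * length (Φ dα′ ++ U ∷ Φ dα ++ D ∷ Φ dβ) ∎
  where
  open ≡-Reasoning
  x = length (Φ dα)
  x′ = length (Φ dα′)
  y = length (Φ dβ)
  rearrange : ∀ x x′ y → 2 + ((2 + (2 * x + 2 * x′)) + 2 * y) ≡ 2 * (x′ + (2 + (x + y)))
  rearrange = solve-∀

data NoneOr (s : Step) : Maybe Step → Set where
  none : NoneOr s nothing
  some : NoneOr s (just s)

nonFlat : Step → Maybe Step
nonFlat F = nothing
nonFlat s = just s

firstNonFlat : Word → Maybe Step
firstNonFlat []      = nothing
firstNonFlat (x ∷ w) = nonFlat x <∣> firstNonFlat w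

lastNonFlat : Word → Maybe Step
lastNonFlat []      = nothing
lastNonFlat (x ∷ w) = lastNonFlat w <∣> nonFlat x

firstNonFlat-++U : ∀ A B → NoneOr U (firstNonFlat A) → NoneOr U (firstNonFlat (A ++ U ∷ B))
firstNonFlat-++U []      B _  = some
firstNonFlat-++U (F ∷ A) B ok = firstNonFlat-++U A B ok
firstNonFlat-++U (U ∷ A) B ok = some

lastNonFlat-++ʳ : ∀ A {B s} → lastNonFlat B ≡ just s → lastNonFlat (A ++ B) ≡ just s
lastNonFlat-++ʳ []      eq = eq
lastNonFlat-++ʳ (x ∷ A) eq = cong (_<∣> nonFlat x) (lastNonFlat-++ʳ A eq)

lastNonFlat-D∷ : ∀ B → NoneOr D (lastNonFlat B) → lastNonFlat (D ∷ B) ≡ just D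
lastNonFlat-D∷ B ok with lastNonFlat B | ok
... | _ | none = refl
... | _ | some = refl

Φ-firstNonFlat : ∀ {w} (d : Dyck w) → NoneOr U (firstNonFlat (Φ d))
Φ-firstNonFlat empty                    = none
Φ-firstNonFlat (node empty dβ)          = Φ-firstNonFlat dβ
Φ-firstNonFlat (node (node dα dα′) dβ) = firstNonFlat-++U (Φ dα′) _ (Φ-firstNonFlat dα′)

Φ-lastNonFlat : ∀ {w} (d : Dyck w) → NoneOr D (lastNonFlat (Φ d))
Φ-lastNonFlat empty = none
Φ-lastNonFlat (node empty dβ) with lastNonFlat (Φ dβ) | Φ-lastNonFlat dβ
... | _ | none = none
... | _ | some = some
Φ-lastNonFlat (node (node dα dα′) dβ) =
  subst (NoneOr D) (sym lastNonFlat≡D) some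
  where
  lastNonFlat≡D : lastNonFlat (Φ dα′ ++ U ∷ Φ dα ++ D ∷ Φ dβ) ≡ just D
  lastNonFlat≡D = lastNonFlat-++ʳ (Φ dα′) (lastNonFlat-++ʳ (U ∷ Φ dα) (lastNonFlat-D∷ (Φ dβ) (Φ-lastNonFlat dβ)))

𝟙 : Bool → ℕ
𝟙 b = if b then 1 else 0

count-[s]-++ : ∀ s A B → count [ s ] (A ++ B) ≡ count [ s ] A + count [ s ] B
count-[s]-++ s []      B = refl
count-[s]-++ s (x ∷ A) B =
  trans (cong (𝟙 (isPrefix [ s ] (x ∷ A)) +_) (count-[s]-++ s A B))
        (sym (+-assoc (𝟙 (isPrefix [ s ] (x ∷ A))) (count [ s ] A) (count [ s ] B)))

DUD : Word
DUD = D ∷ U ∷ D ∷ []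

startsWithUD : Word → Bool
startsWithUD = isPrefix (U ∷ D ∷ [])

isPrefix-++ : ∀ X s B → length X ≤ length s → isPrefix X (s ++ B) ≡ isPrefix X s
isPrefix-++ []      s       B _         = refl
isPrefix-++ (x ∷ X) (y ∷ s) B (s≤s X≤s) with stepEq x y
... | true  = isPrefix-++ X s B X≤s
... | false = refl

last-++∷ : ∀ {X : Set} (xs : List X) y ys → last (xs ++ y ∷ ys) ≡ last (y ∷ ys)
last-++∷ []            y ys = refl
last-++∷ (x ∷ [])      y ys = refl
last-++∷ (x ∷ x′ ∷ xs) y ys = last-++∷ (x′ ∷ xs) y ys

Dyck-last : ∀ {w} → Dyck w → NoneOr D (last w)
Dyck-last empty                = none
Dyck-last (node {α} {β} dα dβ) = subst (NoneOr D) (sym (last-++∷ (U ∷ α) D β)) (last-D∷ dβ)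
  where
  last-D∷ : ∀ {β} → Dyck β → NoneOr D (last (D ∷ β))
  last-D∷ empty        = some
  last-D∷ (node dγ dδ) = Dyck-last (node dγ dδ)

-- DUD has no factor DD, so no occurrence straddles a junction between two D's.
count-DUD-++D : ∀ A b → NoneOr D (last A) → count DUD (A ++ D ∷ b) ≡ count DUD A + count DUD (D ∷ b)
count-DUD-++D []          b _    = refl
count-DUD-++D (D ∷ [])    b some = refl
count-DUD-++D (x ∷ y ∷ r) b ends = begin
  𝟙 (isPrefix DUD (x ∷ y ∷ r ++ D ∷ b)) + count DUD (y ∷ r ++ D ∷ b)
    ≡⟨ cong₂ _+_ (cong 𝟙 (isPrefix-DUD x y r ends)) (count-DUD-++D (y ∷ r) b ends) ⟩
  𝟙 (isPrefix DUD (x ∷ y ∷ r)) + (count DUD (y ∷ r) + count DUD (D ∷ b))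
    ≡⟨ +-assoc (𝟙 (isPrefix DUD (x ∷ y ∷ r))) (count DUD (y ∷ r)) (count DUD (D ∷ b)) ⟨
  𝟙 (isPrefix DUD (x ∷ y ∷ r)) + count DUD (y ∷ r) + count DUD (D ∷ b) ∎
  where
  open ≡-Reasoning
  isPrefix-DUD : ∀ x y r → NoneOr D (last (y ∷ r)) →
                 isPrefix DUD (x ∷ y ∷ r ++ D ∷ b) ≡ isPrefix DUD (x ∷ y ∷ r)
  isPrefix-DUD U D []      some = refl
  isPrefix-DUD D D []      some = refl
  isPrefix-DUD F D []      some = refl
  isPrefix-DUD x y (z ∷ r) _    = isPrefix-++ DUD (x ∷ y ∷ z ∷ r) (D ∷ b) (s≤s (s≤s (s≤s z≤n)))

count-DUD-node : ∀ {α} β → Dyck α →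
                 count DUD (U ∷ α ++ D ∷ β) ≡ count DUD α + (𝟙 (startsWithUD β) + count DUD β)
count-DUD-node {α} β dα = count-DUD-++D α β (Dyck-last dα)

isFlat : Word → Bool
isFlat []      = true
isFlat (F ∷ w) = isFlat w
isFlat _       = false

isNonemptyFlat : Word → Bool
isNonemptyFlat (F ∷ w) = isFlat w
isNonemptyFlat _       = false

startsWithF*D : Word → Bool
startsWithF*D (F ∷ w) = startsWithF*D w
startsWithF*D (D ∷ _) = true
startsWithF*D _       = false

startsWithUF⁺D : Word → Bool
startsWithUF⁺D (U ∷ F ∷ w) = startsWithF*D w
startsWithUF⁺D _           = false

countUF⁺D : Word → ℕ
countUF⁺D []      = 0
countUF⁺D (x ∷ w) = 𝟙 (startsWithUF⁺D (x ∷ w)) + countUF⁺D w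

NoneOr-<∣>ˡ : ∀ {s} m {m′} → NoneOr s (m <∣> m′) → NoneOr s m
NoneOr-<∣>ˡ nothing  _  = none
NoneOr-<∣>ˡ (just _) ok = ok

NoneOrD-<∣>U : ∀ m → NoneOr D (m <∣> just U) → m ≡ just D
NoneOrD-<∣>U (just D) _ = refl
NoneOrD-<∣>U nothing  ()
NoneOrD-<∣>U (just U) ()
NoneOrD-<∣>U (just F) ()

startsWithF*D-++ : ∀ r B → lastNonFlat r ≡ just D → startsWithF*D (r ++ B) ≡ startsWithF*D r
startsWithF*D-++ (F ∷ r) B eq = startsWithF*D-++ r B (trans (sym (<∣>-identityʳ _)) eq)
startsWithF*D-++ (U ∷ r) B _  = refl
startsWithF*D-++ (D ∷ r) B _  = refl

startsWithUF⁺D-++ : ∀ x A B → NoneOr D (lastNonFlat (x ∷ A)) →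
                    startsWithUF⁺D (x ∷ A ++ B) ≡ startsWithUF⁺D (x ∷ A)
startsWithUF⁺D-++ U []      B ()
startsWithUF⁺D-++ U (F ∷ r) B ok =
  startsWithF*D-++ r B (trans (sym (<∣>-identityʳ _)) (NoneOrD-<∣>U (lastNonFlat (F ∷ r)) ok))
startsWithUF⁺D-++ U (U ∷ r) B _ = refl
startsWithUF⁺D-++ U (D ∷ r) B _ = refl
startsWithUF⁺D-++ D A       B _ = refl
startsWithUF⁺D-++ F A       B _ = refl

countUF⁺D-++ : ∀ A B → NoneOr D (lastNonFlat A) → countUF⁺D (A ++ B) ≡ countUF⁺D A + countUF⁺D B
countUF⁺D-++ []      B _  = refl
countUF⁺D-++ (x ∷ A) B ok = begin
  𝟙 (startsWithUF⁺D (x ∷ A ++ B)) + countUF⁺D (A ++ B)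
    ≡⟨ cong₂ _+_ (cong 𝟙 (startsWithUF⁺D-++ x A B ok)) (countUF⁺D-++ A B (NoneOr-<∣>ˡ (lastNonFlat A) ok)) ⟩
  𝟙 (startsWithUF⁺D (x ∷ A)) + (countUF⁺D A + countUF⁺D B)
    ≡⟨ +-assoc (𝟙 (startsWithUF⁺D (x ∷ A))) (countUF⁺D A) (countUF⁺D B) ⟨
  𝟙 (startsWithUF⁺D (x ∷ A)) + countUF⁺D A + countUF⁺D B ∎
  where open ≡-Reasoning

startsWithF*D-++D : ∀ r X → NoneOr U (firstNonFlat r) → startsWithF*D (r ++ D ∷ X) ≡ isFlat r
startsWithF*D-++D []      X _  = refl
startsWithF*D-++D (F ∷ r) X ok = startsWithF*D-++D r X ok
startsWithF*D-++D (U ∷ r) X _  = refl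

startsWithUF⁺D-node : ∀ Q X → NoneOr U (firstNonFlat Q) → startsWithUF⁺D (U ∷ Q ++ D ∷ X) ≡ isNonemptyFlat Q
startsWithUF⁺D-node []      X _  = refl
startsWithUF⁺D-node (F ∷ r) X ok = startsWithF*D-++D r X ok
startsWithUF⁺D-node (U ∷ r) X _  = refl

isNonemptyFlat-++U : ∀ A B → isNonemptyFlat (A ++ U ∷ B) ≡ false
isNonemptyFlat-++U []      B = refl
isNonemptyFlat-++U (F ∷ A) B = isFlat-++U A
  where
  isFlat-++U : ∀ A → isFlat (A ++ U ∷ B) ≡ false
  isFlat-++U []      = refl
  isFlat-++U (F ∷ A) = isFlat-++U A
  isFlat-++U (U ∷ A) = refl
  isFlat-++U (D ∷ A) = refl
isNonemptyFlat-++U (U ∷ A) B = refl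
isNonemptyFlat-++U (D ∷ A) B = refl

sum-applyUpTo-0 : ∀ (f : ℕ → ℕ) L → (∀ i → f i ≡ 0) → sum (applyUpTo f L) ≡ 0
sum-applyUpTo-0 f zero    _    = refl
sum-applyUpTo-0 f (suc L) f≡0 = cong₂ _+_ (f≡0 0) (sum-applyUpTo-0 (f ∘ suc) L (f≡0 ∘ suc))

sum-applyUpTo-+ : ∀ (f g : ℕ → ℕ) L →
                  sum (applyUpTo (λ i → f i + g i) L) ≡ sum (applyUpTo f L) + sum (applyUpTo g L)
sum-applyUpTo-+ f g zero    = refl
sum-applyUpTo-+ f g (suc L) = begin
  f 0 + g 0 + sum (applyUpTo (λ i → f (suc i) + g (suc i)) L)
    ≡⟨ cong (f 0 + g 0 +_) (sum-applyUpTo-+ (f ∘ suc) (g ∘ suc) L) ⟩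
  f 0 + g 0 + (sum (applyUpTo (f ∘ suc) L) + sum (applyUpTo (g ∘ suc) L))
    ≡⟨ +-interchange (f 0) (g 0) _ _ ⟩
  f 0 + sum (applyUpTo (f ∘ suc) L) + (g 0 + sum (applyUpTo (g ∘ suc) L)) ∎
  where open ≡-Reasoning

UFⁱ⁺¹D : ℕ → Word
UFⁱ⁺¹D i = U ∷ replicate (suc i) F ++ [ D ]

sum-isPrefix-FⁱD : ∀ r L → length r < L →
                   sum (applyUpTo (λ i → 𝟙 (isPrefix (replicate i F ++ [ D ]) r)) L) ≡ 𝟙 (startsWithF*D r)
sum-isPrefix-FⁱD []      L       _          = sum-applyUpTo-0 _ L λ { zero → refl ; (suc i) → refl }
sum-isPrefix-FⁱD (U ∷ r) L       _          = sum-applyUpTo-0 _ L λ { zero → refl ; (suc i) → refl }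
sum-isPrefix-FⁱD (D ∷ r) (suc L) _          = cong suc (sum-applyUpTo-0 _ L λ _ → refl)
sum-isPrefix-FⁱD (F ∷ r) (suc L) (s≤s r<L) = sum-isPrefix-FⁱD r L r<L

sum-isPrefix-UFⁱ⁺¹D : ∀ w L → length w ≤ L →
                      sum (applyUpTo (λ i → 𝟙 (isPrefix (UFⁱ⁺¹D i) w)) L) ≡ 𝟙 (startsWithUF⁺D w)
sum-isPrefix-UFⁱ⁺¹D (U ∷ F ∷ r) L w≤L = sum-isPrefix-FⁱD r L (≤-trans (n≤1+n _) w≤L)
sum-isPrefix-UFⁱ⁺¹D []          L _   = sum-applyUpTo-0 _ L λ _ → refl
sum-isPrefix-UFⁱ⁺¹D (U ∷ [])    L _   = sum-applyUpTo-0 _ L λ _ → refl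
sum-isPrefix-UFⁱ⁺¹D (U ∷ U ∷ r) L _   = sum-applyUpTo-0 _ L λ _ → refl
sum-isPrefix-UFⁱ⁺¹D (U ∷ D ∷ r) L _   = sum-applyUpTo-0 _ L λ _ → refl
sum-isPrefix-UFⁱ⁺¹D (D ∷ r)     L _   = sum-applyUpTo-0 _ L λ _ → refl
sum-isPrefix-UFⁱ⁺¹D (F ∷ r)     L _   = sum-applyUpTo-0 _ L λ _ → refl

sum-count-UFⁱ⁺¹D : ∀ Q L → length Q ≤ L → sum (applyUpTo (λ i → count (UFⁱ⁺¹D i) Q) L) ≡ countUF⁺D Q
sum-count-UFⁱ⁺¹D []      L _   = sum-applyUpTo-0 _ L λ _ → refl
sum-count-UFⁱ⁺¹D (x ∷ Q) L Q<L =
  trans (sum-applyUpTo-+ (λ i → 𝟙 (isPrefix (UFⁱ⁺¹D i) (x ∷ Q))) (λ i → count (UFⁱ⁺¹D i) Q) L)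
        (cong₂ _+_ (sum-isPrefix-UFⁱ⁺¹D (x ∷ Q) L Q<L) (sum-count-UFⁱ⁺¹D Q L (≤-trans (n≤1+n _) Q<L)))

countUFplusD≡countUF⁺D : ∀ Q → countUFplusD Q ≡ countUF⁺D Q
countUFplusD≡countUF⁺D Q =
  trans (cong sum (map-upTo (λ i → count (UFⁱ⁺¹D i) Q) (length Q))) (sum-count-UFⁱ⁺¹D Q (length Q) ≤-refl)

toDyck : ∀ {w} → Dhgeq w → Dyck w
toDyck empty        = empty
toDyck (node p q _) = node (toDyck p) (toDyck q)

Φᵈ : ∀ {w} → Dhgeq w → Word
Φᵈ = Φ ∘ toDyck

Φᵈ-isFlat : ∀ {w} (p : Dhgeq w) → h w ≤ 1 → isFlat (Φᵈ p) ≡ true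
Φᵈ-isFlat empty                   _        = refl
Φᵈ-isFlat (node empty q h≤)       _        = Φᵈ-isFlat q h≤
Φᵈ-isFlat (node (node _ _ _) _ _) (s≤s ())

-- After a first prime UD the height condition leaves a remainder of height ≤ 1,
-- i.e. (UD)ᵏ, which Φ sends to Fᵏ.
Φᵈ-isNonemptyFlat : ∀ {w} (p : Dhgeq w) → isNonemptyFlat (Φᵈ p) ≡ startsWithUD w
Φᵈ-isNonemptyFlat empty                    = refl
Φᵈ-isNonemptyFlat (node empty q h≤)        = Φᵈ-isFlat q h≤
Φᵈ-isNonemptyFlat (node (node _ p′ _) _ _) = isNonemptyFlat-++U (Φᵈ p′) _

count-F-++U++D : ∀ A B C → count [ F ] (A ++ U ∷ B ++ D ∷ C) ≡ count [ F ] A + (count [ F ] B + count [ F ] C)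
count-F-++U++D A B C = trans (count-[s]-++ F A _) (cong (count [ F ] A +_) (count-[s]-++ F B (D ∷ C)))

countUF⁺D-Φ-node² : ∀ {α α′ β} (dα : Dyck α) (dα′ : Dyck α′) (dβ : Dyck β) →
                    countUF⁺D (Φ (node (node dα dα′) dβ))
                    ≡ countUF⁺D (Φ dα′) + (𝟙 (isNonemptyFlat (Φ dα)) + (countUF⁺D (Φ dα) + countUF⁺D (Φ dβ)))
countUF⁺D-Φ-node² dα dα′ dβ = begin
  countUF⁺D (Φ dα′ ++ U ∷ Φ dα ++ D ∷ Φ dβ)
    ≡⟨ countUF⁺D-++ (Φ dα′) _ (Φ-lastNonFlat dα′) ⟩
  countUF⁺D (Φ dα′) + (𝟙 (startsWithUF⁺D (U ∷ Φ dα ++ D ∷ Φ dβ)) + countUF⁺D (Φ dα ++ D ∷ Φ dβ))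
    ≡⟨ cong (countUF⁺D (Φ dα′) +_) (cong₂ _+_
         (cong 𝟙 (startsWithUF⁺D-node (Φ dα) (Φ dβ) (Φ-firstNonFlat dα)))
         (countUF⁺D-++ (Φ dα) (D ∷ Φ dβ) (Φ-lastNonFlat dα))) ⟩
  countUF⁺D (Φ dα′) + (𝟙 (isNonemptyFlat (Φ dα)) + (countUF⁺D (Φ dα) + countUF⁺D (Φ dβ))) ∎
  where open ≡-Reasoning

count-F-Φᵈ : ∀ {w} (p : Dhgeq w) →
             count [ F ] (Φᵈ p) ≡ countUF⁺D (Φᵈ p) + count DUD w + 𝟙 (startsWithUD w)
count-F-Φᵈ empty = refl
count-F-Φᵈ (node {β = β} empty q _) =
  trans (cong suc (count-F-Φᵈ q)) (rearrange (countUF⁺D (Φᵈ q)) (count DUD β) (𝟙 (startsWithUD β)))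
  where
  rearrange : ∀ c d s → suc (c + d + s) ≡ c + (s + d) + 1
  rearrange = solve-∀
count-F-Φᵈ (node {β = β} (node {α} {α′} p p′ _) q _) = begin
  count [ F ] (Φᵈ p′ ++ U ∷ Φᵈ p ++ D ∷ Φᵈ q)
    ≡⟨ count-F-++U++D (Φᵈ p′) (Φᵈ p) (Φᵈ q) ⟩
  count [ F ] (Φᵈ p′) + (count [ F ] (Φᵈ p) + count [ F ] (Φᵈ q))
    ≡⟨ cong₂ _+_ (count-F-Φᵈ p′) (cong₂ _+_ (count-F-Φᵈ p) (count-F-Φᵈ q)) ⟩
  (c′ + d′ + s′) + ((c + d + s) + (cβ + dβ + sβ))
    ≡⟨ rearrange c′ d′ s′ c d s cβ dβ sβ ⟩
  (c′ + (s + (c + cβ))) + ((d + (s′ + d′)) + (sβ + dβ)) + 0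
    ≡⟨ cong (_+ 0) (cong₂ _+_ countUF⁺D≡ count-DUD≡) ⟨
  countUF⁺D (Φᵈ p′ ++ U ∷ Φᵈ p ++ D ∷ Φᵈ q) + count DUD (U ∷ (U ∷ α ++ D ∷ α′) ++ D ∷ β) + 0 ∎
  where
  open ≡-Reasoning
  c = countUF⁺D (Φᵈ p)
  c′ = countUF⁺D (Φᵈ p′)
  cβ = countUF⁺D (Φᵈ q)
  d = count DUD α
  d′ = count DUD α′
  dβ = count DUD β
  s = 𝟙 (startsWithUD α)
  s′ = 𝟙 (startsWithUD α′)
  sβ = 𝟙 (startsWithUD β)
  countUF⁺D≡ : countUF⁺D (Φᵈ p′ ++ U ∷ Φᵈ p ++ D ∷ Φᵈ q) ≡ c′ + (s + (c + cβ))
  countUF⁺D≡ = trans (countUF⁺D-Φ-node² (toDyck p) (toDyck p′) (toDyck q))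
                     (cong (λ t → c′ + (𝟙 t + (c + cβ))) (Φᵈ-isNonemptyFlat p))
  count-DUD≡ : count DUD (U ∷ (U ∷ α ++ D ∷ α′) ++ D ∷ β) ≡ (d + (s′ + d′)) + (sβ + dβ)
  count-DUD≡ = trans (count-DUD-node β (node (toDyck p) (toDyck p′)))
                     (cong (_+ (sβ + dβ)) (count-DUD-node α′ (toDyck p)))
  rearrange : ∀ c′ d′ s′ c d s cβ dβ sβ →
              (c′ + d′ + s′) + ((c + d + s) + (cβ + dβ + sβ))
              ≡ (c′ + (s + (c + cβ))) + ((d + (s′ + d′)) + (sβ + dβ)) + 0
  rearrange = solve-∀

wordEq-replicate-F : ∀ Q → wordEq Q (replicate (length Q) F) ≡ isFlat Q
wordEq-replicate-F []      = refl
wordEq-replicate-F (F ∷ Q) = wordEq-replicate-F Q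
wordEq-replicate-F (U ∷ Q) = refl
wordEq-replicate-F (D ∷ Q) = refl

δF-isNonemptyFlat : ∀ n Q → length Q ≡ n → n ≥ 1 → δF n Q ≡ 𝟙 (isNonemptyFlat Q)
δF-isNonemptyFlat _ (F ∷ Q) refl _ = cong 𝟙 (wordEq-replicate-F Q)
δF-isNonemptyFlat _ (U ∷ Q) refl _ = refl
δF-isNonemptyFlat _ (D ∷ Q) refl _ = refl

open import Data.Integer using (+_; _-_) renaming (_+_ to _+ℤ_)
open import Data.Integer.Properties using (pos-+)
open import Data.Integer.Tactic.RingSolver using () renaming (solve-∀ to solve-∀ℤ)

+[c+d+s]-c-s≡d : ∀ c d s → + (c + d + s) - + c - + s ≡ + d
+[c+d+s]-c-s≡d c d s = begin
  + (c + d + s) - + c - + s      ≡⟨ cong (λ t → t - + c - + s) (trans (pos-+ (c + d) s) (cong (_+ℤ + s) (pos-+ c d))) ⟩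
  + c +ℤ + d +ℤ + s - + c - + s  ≡⟨ cancel (+ c) (+ d) (+ s) ⟩
  + d                            ∎
  where
  open ≡-Reasoning
  cancel : ∀ x y z → x +ℤ y +ℤ z - x - z ≡ y
  cancel = solve-∀ℤ

theorem6 : (n : ℕ) → n ≥ 1 → (P : Word) → DhgeqN n P →
    + count (D ∷ U ∷ D ∷ []) P
      ≡ + count (F ∷ []) (φ P) - + countUFplusD (φ P) - + δF n (φ P)
theorem6 n n≥1 P (p , |P|≡2n) = begin
  + count DUD P
    ≡⟨ +[c+d+s]-c-s≡d c (count DUD P) s ⟨
  + (c + count DUD P + s) - + c - + s
    ≡⟨ cong₂ (λ a b → + a - + c - + b) (count-F-Φᵈ p) δF≡s ⟨
  + count [ F ] Q - + c - + δF n Q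
    ≡⟨ cong (λ a → + count [ F ] Q - + a - + δF n Q) (countUFplusD≡countUF⁺D Q) ⟨
  + count [ F ] Q - + countUFplusD Q - + δF n Q
    ≡⟨ cong (λ Q → + count [ F ] Q - + countUFplusD Q - + δF n Q) (φ≡Φ (toDyck p)) ⟨
  + count [ F ] (φ P) - + countUFplusD (φ P) - + δF n (φ P) ∎
  where
  open ≡-Reasoning
  Q = Φᵈ p
  c = countUF⁺D Q
  s = 𝟙 (startsWithUD P)
  |Q|≡n : length Q ≡ n
  |Q|≡n = *-cancelˡ-≡ (length Q) n 2 (trans (sym (length-Φ (toDyck p))) |P|≡2n)
  δF≡s : δF n Q ≡ s
  δF≡s = trans (δF-isNonemptyFlat n Q |Q|≡n n≥1) (cong 𝟙 (Φᵈ-isNonemptyFlat p))
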